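{- The depth of any OR decision tree computing $BPM_n$ satisfies $D^{OR}(BPM_n)\ge 2\log_3(n!)$.
   Context: $BPM_n:\{0,1\}^{n^2}\to\{0,1\}$ maps $(x_{i,j})_{i,j\in[n]}$ to $1$ iff the bipartite graph on left vertices $[n]$, right vertices $[n]$, with edges $\{(i,j):x_{i,j}=1\}$, has a perfect matching. An OR decision tree is a binary tree whose internal nodes are labeled by functions $\bigvee_{i\in S}x_i$ for arbitrary subsets $S$ of input bits and whose leaves are labeled $0/1$; it computes $f$ if for every input the path determined by the node values (right on 1, left on 0) ends at a leaf labeled $f(x)$. $D^{OR}(f)$ is the minimum depth of an OR decision tree computing $f$. -}

module Defs where

open import Data.Nat using (ℕ; zero; suc; _⊔_)
open import Data.Bool using (Bool; true; false; _∧_; _∨_)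
open import Data.Fin using (Fin)
open import Data.List using (List; allFin)
open import Data.Bool.ListAction using (any)
open import Data.Fin.Permutation using (Permutation′; _⟨$⟩ʳ_)
open import Data.Product using (Σ; _×_)
open import Relation.Binary.PropositionalEquality using (_≡_)
open import Function.Bundles using (_⇔_)

-- An input to BPM_n: the n×n bits x_{i,j} (i = left vertex, j = right vertex).
Input : ℕ → Set
Input n = Fin n → Fin n → Bool

BitSet : ℕ → Set
BitSet n = Fin n → Fin n → Bool

orQuery : ∀ {n} → BitSet n → Input n → Bool
orQuery {n} S x = any (λ i → any (λ j → S i j ∧ x i j) (allFin n)) (allFin n)

data ORTree (n : ℕ) : Set where
  leaf : Bool → ORTree n
  node : BitSet n → ORTree n → ORTree n → ORTree n

eval : ∀ {n} → ORTree n → Input n → Bool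
eval (leaf b) x = b
eval (node S l r) x with orQuery S x
... | true  = eval r x
... | false = eval l x

depth : ∀ {n} → ORTree n → ℕ
depth (leaf _) = 0
depth (node _ l r) = suc (depth l ⊔ depth r)

-- The bipartite graph with edges {(i,j) : x_{i,j} = 1} has a perfect matching:
-- a bijection σ : [n] → [n] with every edge (i, σ i) present.
HasPerfectMatching : ∀ {n} → Input n → Set
HasPerfectMatching {n} x = Σ (Permutation′ n) λ σ → ∀ i → x i (σ ⟨$⟩ʳ i) ≡ true

ComputesBPM : ∀ {n} → ORTree n → Set
ComputesBPM {n} T = ∀ (x : Input n) → (eval T x ≡ true) ⇔ HasPerfectMatching x

module Submission where

-- Write zeroOn S x for the 0/1 indicator that x has no edge in S, i.e. ∏_{(i,j) ∈ S} (1 − x i j).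
-- At a node, 1 − T = zeroOn S · (1 − T_l) + (1 − zeroOn S) · (1 − T_r), so a depth-d OR tree T
-- satisfies 1 − T = Σ ± zeroOn Y with at most 3^d terms. Let Z = {(i,j) : i + j < n} and let Δ_Z
-- be the mixed difference over the cells of Z at the all-ones input: Δ_Z (zeroOn Y) is ±1 if
-- Y = Z and 0 otherwise. On inputs that are 1 off Z, a perfect matching exists iff every block
-- {(a,b) : a ≤ t, b + t < n} contains an edge, so 1 − BPM is an inclusion–exclusion over the
-- blocks; block t alone contains the anti-diagonal cell (t, n−1−t), so only the full union Z
-- survives and Δ_Z (1 − BPM) = ±1. Hence Z is one of the sets Y; relabelling rows and columns by
-- permutations r, s, so is every {(i,j) : r i + s j < n}, and these (n!)² sets are distinct.

open import Defs
open import Algebra.Bundles using (CommutativeMonoid)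
open import Data.Bool using (Bool; true; false; not; _∧_; _∨_; if_then_else_)
open import Data.Bool.ListAction using (any; or)
open import Data.Bool.Properties
  using (T-≡; T-∧; ⇔→≡; not-injective; not-involutive; ∧-distribʳ-∨; ∨-zeroʳ; ∧-conicalˡ; ∧-conicalʳ;
         ∨-commutativeMonoid)
open import Algebra.Properties.CommutativeSemigroup
  (CommutativeMonoid.commutativeSemigroup ∨-commutativeMonoid) using (interchange)
open import Data.Fin using (Fin; zero; suc; toℕ; fromℕ<; punchIn; punchOut; remQuot; combine)
import Data.Fin.Properties as Fin
open import Data.Fin.Permutation
  using (Permutation′; _⟨$⟩ʳ_; _⟨$⟩ˡ_; inverseˡ; inverseʳ; insert; insert-punchIn; _∘ₚ_; flip)
import Data.Fin.Permutation as Perm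
open import Data.Integer using (ℤ; 0ℤ; 1ℤ; _+_; _-_; -_; ∣_∣) renaming (_*_ to _·_)
import Data.Integer.Properties as ℤ
open import Data.Integer.Tactic.RingSolver using (solve-∀)
open import Data.List
  using (List; []; _∷_; _++_; [_]; map; allFin; length; lookup; filter; cartesianProduct)
open import Data.List.Properties using (map-cong; map-∘; map-++; length-++; length-map)
open import Data.List.Membership.Propositional using (_∈_; _∉_; lose)
open import Data.List.Membership.Propositional.Properties
  using (∈-allFin; ∈-++⁺ʳ; ∈-filter⁺; ∈-filter⁻; ∈-cartesianProduct⁺)
open import Data.List.Relation.Unary.Any using (Any; here; there; satisfied)
import Data.List.Relation.Unary.Any as Any
open import Data.List.Relation.Unary.Any.Properties using (any⁺; any⁻; map⁻; lookup-index)
open import Data.List.Relation.Unary.Unique.Propositional using (Unique; _∷_)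
open import Data.List.Relation.Unary.Unique.Propositional.Properties
  using (Unique[x∷xs]⇒x∉xs; filter⁺; cartesianProduct⁺; allFin⁺)
open import Data.Nat using (ℕ; zero; suc; _≤_; _<_; _^_; _*_; _⊔_; _∸_; _!; z≤n; s≤s; s≤s⁻¹)
  renaming (_+_ to _+ℕ_)
import Data.Nat.Properties as ℕ
open import Data.Product using (Σ; _×_; _,_; proj₁; proj₂)
open import Data.Product.Properties using (≡-dec)
open import Data.Sum using (inj₁; inj₂)
open import Function using (_∘_)
open import Function.Bundles using (Equivalence; mk⇔)
open import Relation.Binary.PropositionalEquality hiding ([_])
open import Relation.Nullary using (¬_; Dec; yes; no; does; contradiction)
open import Relation.Nullary.Decidable using (_×-dec_; dec-true; dec-false)

private
  variable
    n : ℕ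

Cell : ℕ → Set
Cell n = Fin n × Fin n

_≟ᶜ_ : (c d : Cell n) → Dec (c ≡ d)
_≟ᶜ_ = ≡-dec Fin._≟_ Fin._≟_

Hit : BitSet n → Input n → Set
Hit {n} S x = Σ (Fin n) λ i → Σ (Fin n) λ j → S i j ≡ true × x i j ≡ true

orQuery-sound : (S : BitSet n) (x : Input n) → orQuery S x ≡ true → Hit S x
orQuery-sound {n} S x e with satisfied (any⁻ _ (allFin n) (Equivalence.from T-≡ e))
... | i , hi with satisfied (any⁻ _ (allFin n) hi)
... | j , hij = let (s , t) = Equivalence.to T-∧ hij in i , j , Equivalence.to T-≡ s , Equivalence.to T-≡ t

orQuery-complete : (S : BitSet n) (x : Input n) → Hit S x → orQuery S x ≡ true
orQuery-complete {n} S x (i , j , s , t) =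
  Equivalence.to T-≡ (any⁺ _ (lose (∈-allFin i) (any⁺ _ (lose (∈-allFin j)
    (Equivalence.from T-∧ (Equivalence.from T-≡ s , Equivalence.from T-≡ t))))))

orQuery-false : (S : BitSet n) (x : Input n) → ¬ Hit S x → orQuery S x ≡ false
orQuery-false S x ¬hit with orQuery S x in e
... | false = refl
... | true  = contradiction (orQuery-sound S x e) ¬hit

orQuery-cong : (S S′ : BitSet n) (x x′ : Input n) →
  (∀ i j → S i j ∧ x i j ≡ S′ i j ∧ x′ i j) → orQuery S x ≡ orQuery S′ x′
orQuery-cong {n} S S′ x x′ e =
  cong or (map-cong (λ i → cong or (map-cong (e i) (allFin n))) (allFin n))

any-∨ : ∀ {A : Set} (p q : A → Bool) (xs : List A) →
  any (λ a → p a ∨ q a) xs ≡ any p xs ∨ any q xs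
any-∨ p q [] = refl
any-∨ p q (a ∷ xs) rewrite any-∨ p q xs = interchange (p a) (q a) (any p xs) (any q xs)

_∪_ : BitSet n → BitSet n → BitSet n
(S ∪ Y) i j = S i j ∨ Y i j

∅ : BitSet n
∅ i j = false

orQuery-∪ : (S Y : BitSet n) (x : Input n) → orQuery (S ∪ Y) x ≡ orQuery S x ∨ orQuery Y x
orQuery-∪ {n} S Y x = begin
  orQuery (S ∪ Y) x
    ≡⟨ cong or (map-cong (λ i → cong or (map-cong (λ j → ∧-distribʳ-∨ (x i j) (S i j) (Y i j))
                                                  (allFin n))) (allFin n)) ⟩
  any (λ i → any (λ j → S i j ∧ x i j ∨ Y i j ∧ x i j) (allFin n)) (allFin n)
    ≡⟨ cong or (map-cong (λ i → any-∨ (λ j → S i j ∧ x i j) (λ j → Y i j ∧ x i j) (allFin n)) (allFin n)) ⟩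
  any (λ i → any (λ j → S i j ∧ x i j) (allFin n) ∨ any (λ j → Y i j ∧ x i j) (allFin n)) (allFin n)
    ≡⟨ any-∨ _ _ (allFin n) ⟩
  orQuery S x ∨ orQuery Y x ∎
  where open ≡-Reasoning

𝟙 : Bool → ℤ
𝟙 b = if b then 1ℤ else 0ℤ

𝟙-∨ : ∀ a b → 𝟙 (a ∨ b) ≡ 𝟙 a + 𝟙 b - 𝟙 a · 𝟙 b
𝟙-∨ true  true  = refl
𝟙-∨ true  false = refl
𝟙-∨ false true  = refl
𝟙-∨ false false = refl

zeroOn : BitSet n → Input n → ℤ
zeroOn S x = 𝟙 (not (orQuery S x))

zeroOn-∪ : (S Y : BitSet n) (x : Input n) → zeroOn (S ∪ Y) x ≡ zeroOn S x · zeroOn Y x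
zeroOn-∪ S Y x rewrite orQuery-∪ S Y x with orQuery S x | orQuery Y x
... | true  | true  = refl
... | true  | false = refl
... | false | true  = refl
... | false | false = refl

zeroOn-∅ : (x : Input n) → zeroOn ∅ x ≡ 1ℤ
zeroOn-∅ x rewrite orQuery-false ∅ x (λ ()) = refl

zeroOn-hit : ∀ (Y : BitSet n) {x} → Hit Y x → zeroOn Y x ≡ 0ℤ
zeroOn-hit Y {x} hit rewrite orQuery-complete Y x hit = refl

zeroOn-∪-∨ : ∀ (P B : BitSet n) h y →
  zeroOn P y · 𝟙 (not (orQuery B y) ∨ h) ≡ zeroOn (P ∪ B) y + (zeroOn P y · 𝟙 h - zeroOn (P ∪ B) y · 𝟙 h)
zeroOn-∪-∨ P B h y
  rewrite 𝟙-∨ (not (orQuery B y)) h | zeroOn-∪ P B y = expand (zeroOn P y) (zeroOn B y) (𝟙 h)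
  where
  expand : ∀ p b h → p · (b + h - b · h) ≡ p · b + (p · h - p · b · h)
  expand = solve-∀

-- Mixed differences over a list of cells

update : Cell n → Bool → Input n → Input n
update c b x i j = if does ((i , j) ≟ᶜ c) then b else x i j

update-same : ∀ i j b (x : Input n) → update (i , j) b x i j ≡ b
update-same i j b x rewrite dec-true ((i , j) ≟ᶜ (i , j)) refl = refl

update-other : ∀ {c : Cell n} {i j} b x → (i , j) ≢ c → update c b x i j ≡ x i j
update-other {c = c} {i} {j} b x ne rewrite dec-false ((i , j) ≟ᶜ c) ne = refl

_≈_off_ : Input n → Input n → List (Cell n) → Set
x ≈ y off K = ∀ i j → (i , j) ∉ K → x i j ≡ y i j

Ignores : ∀ {A : Set} → List (Cell n) → (Input n → A) → Set
Ignores K ψ = ∀ x y → x ≈ y off K → ψ x ≡ ψ y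

Ignores-· : ∀ {K : List (Cell n)} {ψ ψ′} → Ignores K ψ → Ignores K ψ′ → Ignores K (λ y → ψ y · ψ′ y)
Ignores-· ign ign′ x y x≈y = cong₂ _·_ (ign x y x≈y) (ign′ x y x≈y)

orQuery-ignores : ∀ (Y : BitSet n) {i j} → Y i j ≡ false → Ignores [ (i , j) ] (orQuery Y)
orQuery-ignores Y {i} {j} Yij x y x≈y = orQuery-cong Y Y x y agree
  where
  agree : ∀ a b → Y a b ∧ x a b ≡ Y a b ∧ y a b
  agree a b with (a , b) ≟ᶜ (i , j)
  ... | yes refl rewrite Yij = refl
  ... | no ne    = cong (Y a b ∧_) (x≈y a b λ { (here e) → ne e })

zeroOn-ignores : ∀ (Y : BitSet n) {i j} → Y i j ≡ false → Ignores [ (i , j) ] (zeroOn Y)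
zeroOn-ignores Y Yij x y x≈y = cong (𝟙 ∘ not) (orQuery-ignores Y Yij x y x≈y)

-- For multilinear ψ, Δ L ψ x is the coefficient of ∏_{c ∈ L} x c, the cells off L fixed as in x.
Δ : List (Cell n) → (Input n → ℤ) → Input n → ℤ
Δ []      ψ x = ψ x
Δ (c ∷ L) ψ x = Δ L ψ (update c true x) - Δ L ψ (update c false x)

update-≈ : ∀ {c : Cell n} {K x y} b → x ≈ y off (c ∷ K) → update c b x ≈ update c b y off K
update-≈ {c = c} b x≈y i j ∉K with (i , j) ≟ᶜ c
... | yes _ = refl
... | no ne = x≈y i j λ { (here e) → ne e ; (there ∈K) → ∉K ∈K }

≈-update : ∀ {c : Cell n} {L x y} b → update c b x ≈ y off L → x ≈ y off (c ∷ L)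
≈-update {x = x} b u≈y i j ∉c∷L =
  trans (sym (update-other b x (∉c∷L ∘ here))) (u≈y i j (∉c∷L ∘ there))

Δ-ignores : ∀ (L : List (Cell n)) {K ψ} → Ignores K ψ → Ignores (L ++ K) (Δ L ψ)
Δ-ignores []      ign x y x≈y = ign x y x≈y
Δ-ignores (c ∷ L) ign x y x≈y =
  cong₂ _-_ (Δ-ignores L ign _ _ (update-≈ true x≈y)) (Δ-ignores L ign _ _ (update-≈ false x≈y))

Δ-cong : ∀ (L : List (Cell n)) {ψ ψ′ x} → (∀ y → x ≈ y off L → ψ y ≡ ψ′ y) → Δ L ψ x ≡ Δ L ψ′ x
Δ-cong []      eq = eq _ (λ _ _ _ → refl)
Δ-cong (c ∷ L) eq =
  cong₂ _-_ (Δ-cong L λ y u≈y → eq y (≈-update true u≈y)) (Δ-cong L λ y u≈y → eq y (≈-update false u≈y))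

Δ-zero : ∀ (L : List (Cell n)) x → Δ L (λ _ → 0ℤ) x ≡ 0ℤ
Δ-zero []      x = refl
Δ-zero (c ∷ L) x rewrite Δ-zero L (update c true x) | Δ-zero L (update c false x) = refl

Δ-locally-zero : ∀ (L : List (Cell n)) {ψ x} → (∀ y → x ≈ y off L → ψ y ≡ 0ℤ) → Δ L ψ x ≡ 0ℤ
Δ-locally-zero L eq = trans (Δ-cong L eq) (Δ-zero L _)

Δ-ignored : ∀ (L : List (Cell n)) {c ψ} → c ∈ L → Ignores [ c ] ψ → ∀ x → Δ L ψ x ≡ 0ℤ
Δ-ignored (c ∷ L) {ψ = ψ} (here refl) ign x =
  trans (cong (_- rest) (Δ-ignores L ign _ _ agree)) (ℤ.+-inverseʳ rest)
  where
  rest = Δ L ψ (update c false x)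
  agree : update c true x ≈ update c false x off (L ++ [ c ])
  agree i j ∉L++c = trans (update-other true x ne) (sym (update-other false x ne))
    where ne = ∉L++c ∘ ∈-++⁺ʳ L ∘ here
Δ-ignored (d ∷ L) (there c∈L) ign x
  rewrite Δ-ignored L c∈L ign (update d true x) | Δ-ignored L c∈L ign (update d false x) = refl

Δ-+ : ∀ (L : List (Cell n)) ψ ψ′ x → Δ L (λ y → ψ y + ψ′ y) x ≡ Δ L ψ x + Δ L ψ′ x
Δ-+ []      ψ ψ′ x = refl
Δ-+ (c ∷ L) ψ ψ′ x
  rewrite Δ-+ L ψ ψ′ (update c true x) | Δ-+ L ψ ψ′ (update c false x) =
    interchange-− (Δ L ψ (update c true x)) (Δ L ψ′ (update c true x))
                  (Δ L ψ (update c false x)) (Δ L ψ′ (update c false x))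
  where
  interchange-− : ∀ a b a′ b′ → (a + b) - (a′ + b′) ≡ (a - a′) + (b - b′)
  interchange-− = solve-∀

Δ-− : ∀ (L : List (Cell n)) ψ ψ′ x → Δ L (λ y → ψ y - ψ′ y) x ≡ Δ L ψ x - Δ L ψ′ x
Δ-− []      ψ ψ′ x = refl
Δ-− (c ∷ L) ψ ψ′ x
  rewrite Δ-− L ψ ψ′ (update c true x) | Δ-− L ψ ψ′ (update c false x) =
    interchange-− (Δ L ψ (update c true x)) (Δ L ψ′ (update c true x))
                  (Δ L ψ (update c false x)) (Δ L ψ′ (update c false x))
  where
  interchange-− : ∀ a b a′ b′ → (a - b) - (a′ - b′) ≡ (a - a′) - (b - b′)
  interchange-− = solve-∀

Δ-scale : ∀ (L : List (Cell n)) a ψ x → Δ L (λ y → a · ψ y) x ≡ a · Δ L ψ x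
Δ-scale []      a ψ x = refl
Δ-scale (c ∷ L) a ψ x
  rewrite Δ-scale L a ψ (update c true x) | Δ-scale L a ψ (update c false x) =
    distrib-− a (Δ L ψ (update c true x)) (Δ L ψ (update c false x))
  where
  distrib-− : ∀ a b b′ → a · b - a · b′ ≡ a · (b - b′)
  distrib-− = solve-∀

Δ-zeroOn-missing : ∀ (L : List (Cell n)) {Y i j} → (i , j) ∈ L → Y i j ≡ false → ∀ x →
  Δ L (zeroOn Y) x ≡ 0ℤ
Δ-zeroOn-missing L {Y} ij∈L Yij = Δ-ignored L ij∈L (zeroOn-ignores Y Yij)

Δ-zeroOn-extra : ∀ (L : List (Cell n)) {Y i j x} → (i , j) ∉ L → Y i j ≡ true → x i j ≡ true →
  Δ L (zeroOn Y) x ≡ 0ℤ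
Δ-zeroOn-extra L {Y} {i} {j} ij∉L Yij xij =
  Δ-locally-zero L λ y x≈y → zeroOn-hit Y (i , j , Yij , trans (sym (x≈y i j ij∉L)) xij)

-- Setting the first cell to 1 kills zeroOn Y; setting it to 0 removes that cell from Y.
Δ-zeroOn-unit : ∀ (L : List (Cell n)) {Y x} → Unique L →
  (∀ {i j} → (i , j) ∈ L → Y i j ≡ true) →
  (∀ i j → (i , j) ∉ L → Y i j ≡ true → x i j ≡ false) →
  ∣ Δ L (zeroOn Y) x ∣ ≡ 1
Δ-zeroOn-unit [] {Y} {x} _ _ outside =
  cong ∣_∣ (cong (𝟙 ∘ not) (orQuery-false Y x λ (i , j , Yij , xij) →
    contradiction (trans (sym xij) (outside i j (λ ()) Yij)) λ ()))
Δ-zeroOn-unit ((i , j) ∷ L) {Y} {x} c∷L-unique@(_ ∷ L-unique) inside outside = begin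
  ∣ Δ L (zeroOn Y) (update (i , j) true x) - rest ∣
    ≡⟨ cong (λ a → ∣ a - rest ∣) (Δ-zeroOn-extra L c∉L (inside (here refl)) (update-same i j true x)) ⟩
  ∣ 0ℤ - rest ∣  ≡⟨ cong ∣_∣ (ℤ.+-identityˡ (- rest)) ⟩
  ∣ - rest ∣     ≡⟨ ℤ.∣-i∣≡∣i∣ rest ⟩
  ∣ rest ∣       ≡⟨ Δ-zeroOn-unit L L-unique (inside ∘ there) outside′ ⟩
  1 ∎
  where
  open ≡-Reasoning
  c∉L = Unique[x∷xs]⇒x∉xs c∷L-unique
  rest = Δ L (zeroOn Y) (update (i , j) false x)
  outside′ : ∀ a b → (a , b) ∉ L → Y a b ≡ true → update (i , j) false x a b ≡ false
  outside′ a b ab∉L Yab with (a , b) ≟ᶜ (i , j)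
  ... | yes refl = refl
  ... | no ne    = outside a b (λ { (here e) → ne e ; (there ab∈L) → ab∉L ab∈L }) Yab

-- Expansion of an OR tree

rejects : ORTree n → Input n → ℤ
rejects T x = 𝟙 (not (eval T x))

Term : ℕ → Set
Term n = ℤ × BitSet n

evalTerms : List (Term n) → Input n → ℤ
evalTerms []             x = 0ℤ
evalTerms ((a , Y) ∷ ts) x = a · zeroOn Y x + evalTerms ts x

restrict : BitSet n → Term n → Term n
restrict S (a , Y) = a , S ∪ Y

negate : Term n → Term n
negate (a , Y) = - a , Y

expansion : ORTree n → List (Term n)
expansion (leaf true)  = []
expansion (leaf false) = [ 1ℤ , ∅ ]
expansion (node S l r) =
  map (restrict S) (expansion l) ++ expansion r ++ map (restrict S ∘ negate) (expansion r)

evalTerms-++ : ∀ (ts us : List (Term n)) x → evalTerms (ts ++ us) x ≡ evalTerms ts x + evalTerms us x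
evalTerms-++ []             us x = sym (ℤ.+-identityˡ _)
evalTerms-++ ((a , Y) ∷ ts) us x rewrite evalTerms-++ ts us x =
  sym (ℤ.+-assoc (a · zeroOn Y x) (evalTerms ts x) (evalTerms us x))

evalTerms-restrict : ∀ S (ts : List (Term n)) x →
  evalTerms (map (restrict S) ts) x ≡ zeroOn S x · evalTerms ts x
evalTerms-restrict S []             x = sym (ℤ.*-zeroʳ (zeroOn S x))
evalTerms-restrict S ((a , Y) ∷ ts) x rewrite evalTerms-restrict S ts x | zeroOn-∪ S Y x =
  factor a (zeroOn S x) (zeroOn Y x) (evalTerms ts x)
  where
  factor : ∀ a s y e → a · (s · y) + s · e ≡ s · (a · y + e)
  factor = solve-∀

evalTerms-negate : ∀ (ts : List (Term n)) x → evalTerms (map negate ts) x ≡ - evalTerms ts x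
evalTerms-negate []             x = refl
evalTerms-negate ((a , Y) ∷ ts) x rewrite evalTerms-negate ts x =
  negate-sum a (zeroOn Y x) (evalTerms ts x)
  where
  negate-sum : ∀ a y e → - a · y + - e ≡ - (a · y + e)
  negate-sum = solve-∀

rejects-node : ∀ S (l r : ORTree n) x →
  rejects (node S l r) x ≡ zeroOn S x · rejects l x + (rejects r x + zeroOn S x · - rejects r x)
rejects-node S l r x with orQuery S x
... | true  = sym (drop-left (rejects l x) (rejects r x))
  where
  drop-left : ∀ a b → 0ℤ · a + (b + 0ℤ · - b) ≡ b
  drop-left = solve-∀
... | false = sym (drop-right (rejects l x) (rejects r x))
  where
  drop-right : ∀ a b → 1ℤ · a + (b + 1ℤ · - b) ≡ a
  drop-right = solve-∀

rejects≡evalTerms : ∀ (T : ORTree n) x → rejects T x ≡ evalTerms (expansion T) x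
rejects≡evalTerms (leaf true)  x = refl
rejects≡evalTerms (leaf false) x =
  sym (trans (ℤ.+-identityʳ _) (trans (ℤ.*-identityˡ _) (zeroOn-∅ x)))
rejects≡evalTerms (node S l r) x = begin
  rejects (node S l r) x
    ≡⟨ rejects-node S l r x ⟩
  zeroOn S x · rejects l x + (rejects r x + zeroOn S x · - rejects r x)
    ≡⟨ cong₂ (λ a b → zeroOn S x · a + (b + zeroOn S x · - b))
             (rejects≡evalTerms l x) (rejects≡evalTerms r x) ⟩
  zeroOn S x · evalTerms el x + (evalTerms er x + zeroOn S x · - evalTerms er x)
    ≡⟨ sym (cong₂ _+_ (evalTerms-restrict S el x) (cong (evalTerms er x +_) restrict-negate)) ⟩
  evalTerms (map (restrict S) el) x + (evalTerms er x + evalTerms (map (restrict S ∘ negate) er) x)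
    ≡⟨ sym (trans (evalTerms-++ (map (restrict S) el) (er ++ ner) x)
                  (cong (evalTerms (map (restrict S) el) x +_) (evalTerms-++ er ner x))) ⟩
  evalTerms (expansion (node S l r)) x ∎
  where
  open ≡-Reasoning
  el = expansion l
  er = expansion r
  ner = map (restrict S ∘ negate) er
  restrict-negate : evalTerms (map (restrict S ∘ negate) er) x ≡ zeroOn S x · - evalTerms er x
  restrict-negate = begin
    evalTerms (map (restrict S ∘ negate) er) x     ≡⟨ cong (λ ts → evalTerms ts x) (map-∘ er) ⟩
    evalTerms (map (restrict S) (map negate er)) x ≡⟨ evalTerms-restrict S (map negate er) x ⟩
    zeroOn S x · evalTerms (map negate er) x      ≡⟨ cong (zeroOn S x ·_) (evalTerms-negate er x) ⟩
    zeroOn S x · - evalTerms er x ∎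

length-expansion : ∀ (T : ORTree n) → length (expansion T) ≤ 3 ^ depth T
length-expansion (leaf true)  = z≤n
length-expansion (leaf false) = s≤s z≤n
length-expansion (node S l r) = begin
  length (map (restrict S) el ++ er ++ map (restrict S ∘ negate) er)
    ≡⟨ trans (length-++ (map (restrict S) el)) (cong₂ _+ℕ_ (length-map _ el)
         (trans (length-++ er) (cong (length er +ℕ_) (length-map _ er)))) ⟩
  length el +ℕ (length er +ℕ length er)
    ≤⟨ ℕ.+-mono-≤ (bound l (ℕ.m≤m⊔n _ _)) (ℕ.+-mono-≤ (bound r (ℕ.m≤n⊔m _ _)) (bound r (ℕ.m≤n⊔m _ _))) ⟩
  3 ^ d +ℕ (3 ^ d +ℕ 3 ^ d)
    ≡⟨ cong (λ k → 3 ^ d +ℕ (3 ^ d +ℕ k)) (sym (ℕ.+-identityʳ (3 ^ d))) ⟩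
  3 ^ suc d ∎
  where
  open ℕ.≤-Reasoning
  el = expansion l
  er = expansion r
  d = depth l ⊔ depth r
  bound : ∀ (T′ : ORTree _) → depth T′ ≤ d → length (expansion T′) ≤ 3 ^ d
  bound T′ le = ℕ.≤-trans (length-expansion T′) (ℕ.^-monoʳ-≤ 3 le)

Δ-evalTerms-support : ∀ (L : List (Cell n)) ts x → Δ L (evalTerms ts) x ≢ 0ℤ →
  Any (λ t → Δ L (zeroOn (proj₂ t)) x ≢ 0ℤ) ts
Δ-evalTerms-support L []             x nz = contradiction (Δ-zero L x) nz
Δ-evalTerms-support L ((a , Y) ∷ ts) x nz with Δ L (zeroOn Y) x ℤ.≟ 0ℤ
... | no  ≢0 = here ≢0
... | yes ≡0 = there (Δ-evalTerms-support L ts x λ rest≡0 → nz (begin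
  Δ L (λ y → a · zeroOn Y y + evalTerms ts y) x
    ≡⟨ Δ-+ L (λ y → a · zeroOn Y y) (evalTerms ts) x ⟩
  Δ L (λ y → a · zeroOn Y y) x + Δ L (evalTerms ts) x
    ≡⟨ cong₂ _+_ (trans (Δ-scale L a (zeroOn Y) x) (cong (a ·_) ≡0)) rest≡0 ⟩
  a · 0ℤ + 0ℤ
    ≡⟨ trans (ℤ.+-identityʳ _) (ℤ.*-zeroʳ a) ⟩
  0ℤ ∎))
  where open ≡-Reasoning

-- Inclusion–exclusion over a chain of blocks, each owning a private corner cell of L:
-- only the full union of the blocks contributes to the top difference over L.
module Chain (L : List (Cell n)) (L-unique : Unique L) (k : ℕ) (block : ℕ → BitSet n)
  (corner : ∀ t → t < k → Cell n)
  (corner∈L : ∀ t (t<k : t < k) → corner t t<k ∈ L)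
  (corner-private : ∀ t (t<k : t < k) s → s ≢ t →
                    block s (proj₁ (corner t t<k)) (proj₂ (corner t t<k)) ≡ false)
  (block⊆L : ∀ s i j → s < k → block s i j ≡ true → (i , j) ∈ L)
  (L⊆blocks : ∀ {i j} → (i , j) ∈ L → Σ ℕ λ s → s < k × block s i j ≡ true)
  where

  prefix : ℕ → BitSet n
  prefix zero    = ∅
  prefix (suc t) = prefix t ∪ block t

  someEmpty : ℕ → ℕ → Input n → Bool
  someEmpty zero    t y = false
  someEmpty (suc d) t y = not (orQuery (block t) y) ∨ someEmpty d (suc t) y

  prefix-avoids : ∀ t {i j} → (∀ s → s < t → block s i j ≡ false) → prefix t i j ≡ false
  prefix-avoids zero    avoid = refl
  prefix-avoids (suc t) avoid
    rewrite prefix-avoids t (λ s s<t → avoid s (ℕ.m<n⇒m<1+n s<t)) = avoid t ℕ.≤-refl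

  prefix-sound : ∀ t {i j} → prefix t i j ≡ true → Σ ℕ λ s → s < t × block s i j ≡ true
  prefix-sound (suc t) {i} {j} e with prefix t i j in p
  ... | true  = let (s , s<t , b) = prefix-sound t p in s , ℕ.m<n⇒m<1+n s<t , b
  ... | false = t , ℕ.≤-refl , e

  prefix-complete : ∀ t {s i j} → s < t → block s i j ≡ true → prefix t i j ≡ true
  prefix-complete (suc t) {s} {i} {j} s<1+t b with ℕ.m≤n⇒m<n∨m≡n (s≤s⁻¹ s<1+t)
  ... | inj₁ s<t  rewrite prefix-complete t s<t b = refl
  ... | inj₂ refl rewrite b = ∨-zeroʳ (prefix s i j)

  someEmpty-ignores : ∀ d t {i j} → (∀ s → t ≤ s → block s i j ≡ false) →
    Ignores [ (i , j) ] (someEmpty d t)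
  someEmpty-ignores zero    t avoid x y x≈y = refl
  someEmpty-ignores (suc d) t avoid x y x≈y =
    cong₂ (λ a b → not a ∨ b) (orQuery-ignores (block t) (avoid t ℕ.≤-refl) x y x≈y)
      (someEmpty-ignores d (suc t) (λ s t<s → avoid s (ℕ.<⇒≤ t<s)) x y x≈y)

  someEmpty-false⁻ : ∀ d t y → someEmpty d t y ≡ false →
    ∀ s → t ≤ s → s < t +ℕ d → orQuery (block s) y ≡ true
  someEmpty-false⁻ (suc d) t y e s t≤s s<t+1+d with orQuery (block t) y in hit | ℕ.m≤n⇒m<n∨m≡n t≤s
  ... | true | inj₂ refl = hit
  ... | true | inj₁ t<s  =
    someEmpty-false⁻ d (suc t) y e s t<s (subst (s <_) (ℕ.+-suc t d) s<t+1+d)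
  someEmpty-false⁻ zero t y e s t≤s s<t+0 = contradiction (subst (s <_) (ℕ.+-identityʳ t) s<t+0) (ℕ.≤⇒≯ t≤s)

  someEmpty-false⁺ : ∀ d t y → (∀ s → t ≤ s → s < t +ℕ d → orQuery (block s) y ≡ true) →
    someEmpty d t y ≡ false
  someEmpty-false⁺ zero    t y hits = refl
  someEmpty-false⁺ (suc d) t y hits rewrite hits t ℕ.≤-refl (ℕ.m<m+n t (s≤s z≤n)) =
    someEmpty-false⁺ d (suc t) y λ s t<s s<… → hits s (ℕ.<⇒≤ t<s) (subst (s <_) (sym (ℕ.+-suc t d)) s<…)

  chain : ℕ → ℕ → Input n → ℤ
  chain d t = Δ L (λ y → zeroOn (prefix t) y · 𝟙 (someEmpty d t y))

  chain-zero : ∀ t x → chain 0 t x ≡ 0ℤ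
  chain-zero t x = Δ-locally-zero L λ y _ → ℤ.*-zeroʳ (zeroOn (prefix t) y)

  chain-step : ∀ d t x → chain (suc d) t x ≡
    Δ L (zeroOn (prefix (suc t))) x
      + (Δ L (λ y → zeroOn (prefix t) y · 𝟙 (someEmpty d (suc t) y)) x - chain d (suc t) x)
  chain-step d t x = begin
    chain (suc d) t x
      ≡⟨ Δ-cong L (λ y _ → zeroOn-∪-∨ (prefix t) (block t) (someEmpty d (suc t) y) y) ⟩
    Δ L (λ y → zeroOn (prefix (suc t)) y + (zP y · h y - zP′ y · h y)) x
      ≡⟨ Δ-+ L (zeroOn (prefix (suc t))) (λ y → zP y · h y - zP′ y · h y) x ⟩
    Δ L zP′ x + Δ L (λ y → zP y · h y - zP′ y · h y) x
      ≡⟨ cong (Δ L zP′ x +_) (Δ-− L (λ y → zP y · h y) (λ y → zP′ y · h y) x) ⟩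
    Δ L zP′ x + (Δ L (λ y → zP y · h y) x - chain d (suc t) x) ∎
    where
    open ≡-Reasoning
    zP  = zeroOn (prefix t)
    zP′ = zeroOn (prefix (suc t))
    h   = λ y → 𝟙 (someEmpty d (suc t) y)

  prefix-misses-corner : ∀ t u (u<k : u < k) → t ≤ u →
    prefix t (proj₁ (corner u u<k)) (proj₂ (corner u u<k)) ≡ false
  prefix-misses-corner t u u<k t≤u =
    prefix-avoids t λ s s<t → corner-private u u<k s (ℕ.<⇒≢ (ℕ.<-≤-trans s<t t≤u))

  short-prefix-vanishes : ∀ t u → u < k → t ≤ u → ∀ x → Δ L (zeroOn (prefix t)) x ≡ 0ℤ
  short-prefix-vanishes t u u<k t≤u =
    Δ-zeroOn-missing L (corner∈L u u<k) (prefix-misses-corner t u u<k t≤u)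

  -- The corner of block t lies neither in the earlier nor in the later blocks.
  skipped-block-vanishes : ∀ d t → t < k → ∀ x →
    Δ L (λ y → zeroOn (prefix t) y · 𝟙 (someEmpty d (suc t) y)) x ≡ 0ℤ
  skipped-block-vanishes d t t<k = Δ-ignored L (corner∈L t t<k)
    (Ignores-· (zeroOn-ignores (prefix t) (prefix-misses-corner t t t<k ℕ.≤-refl))
               (λ x y x≈y → cong 𝟙 (someEmpty-ignores d (suc t)
                  (λ s t<s → corner-private t t<k s (≢-sym (ℕ.<⇒≢ t<s))) x y x≈y)))

  full-prefix-unit : ∀ x → ∣ Δ L (zeroOn (prefix k)) x ∣ ≡ 1
  full-prefix-unit x = Δ-zeroOn-unit L L-unique inside outside
    where
    inside : ∀ {i j} → (i , j) ∈ L → prefix k i j ≡ true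
    inside ij∈L = let (s , s<k , b) = L⊆blocks ij∈L in prefix-complete k s<k b
    outside : ∀ i j → (i , j) ∉ L → prefix k i j ≡ true → x i j ≡ false
    outside i j ij∉L p = let (s , s<k , b) = prefix-sound k p in contradiction (block⊆L s i j s<k b) ij∉L

  chain-unit : ∀ d t x → t +ℕ suc d ≡ k → ∣ chain (suc d) t x ∣ ≡ 1
  chain-unit zero t x t+1≡k = begin
    ∣ chain 1 t x ∣
      ≡⟨ cong ∣_∣ (trans (chain-step 0 t x) (cong₂ (λ a b → Δ L (zeroOn (prefix (suc t))) x + (a - b))
                                               (chain-zero t x) (chain-zero (suc t) x))) ⟩
    ∣ Δ L (zeroOn (prefix (suc t))) x + 0ℤ ∣
      ≡⟨ cong (λ a → ∣ Δ L (zeroOn (prefix a)) x + 0ℤ ∣) (trans (sym (ℕ.+-comm t 1)) t+1≡k) ⟩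
    ∣ Δ L (zeroOn (prefix k)) x + 0ℤ ∣
      ≡⟨ cong ∣_∣ (ℤ.+-identityʳ (Δ L (zeroOn (prefix k)) x)) ⟩
    ∣ Δ L (zeroOn (prefix k)) x ∣
      ≡⟨ full-prefix-unit x ⟩
    1 ∎
    where open ≡-Reasoning
  chain-unit (suc d) t x t+d+2≡k = begin
    ∣ chain (suc (suc d)) t x ∣
      ≡⟨ cong ∣_∣ (trans (chain-step (suc d) t x) (cong₂ (λ a b → a + (b - chain (suc d) (suc t) x))
           (short-prefix-vanishes (suc t) (t +ℕ suc d) last<k (ℕ.m<m+n t (s≤s z≤n)) x)
           (skipped-block-vanishes (suc d) t (ℕ.<-≤-trans (ℕ.m<m+n t (s≤s z≤n)) (ℕ.<⇒≤ last<k)) x))) ⟩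
    ∣ 0ℤ + (0ℤ - chain (suc d) (suc t) x) ∣
      ≡⟨ cong ∣_∣ (trans (ℤ.+-identityˡ (0ℤ - next)) (ℤ.+-identityˡ (- next))) ⟩
    ∣ - next ∣
      ≡⟨ ℤ.∣-i∣≡∣i∣ next ⟩
    ∣ chain (suc d) (suc t) x ∣
      ≡⟨ chain-unit d (suc t) x (trans (sym (ℕ.+-suc t (suc d))) t+d+2≡k) ⟩
    1 ∎
    where
    open ≡-Reasoning
    next = chain (suc d) (suc t) x
    last<k : t +ℕ suc d < k
    last<k = subst (t +ℕ suc d <_) t+d+2≡k (ℕ.+-monoʳ-< t (ℕ.n<1+n (suc d)))

  Δ-someEmpty-unit : ∀ {d} → k ≡ suc d → ∀ x → ∣ Δ L (𝟙 ∘ someEmpty k 0) x ∣ ≡ 1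
  Δ-someEmpty-unit {d} k≡1+d x = begin
    ∣ Δ L (𝟙 ∘ someEmpty k 0) x ∣ ≡⟨ cong ∣_∣ (Δ-cong L λ y _ → sym (empty-prefix y)) ⟩
    ∣ chain k 0 x ∣               ≡⟨ cong (λ k′ → ∣ chain k′ 0 x ∣) k≡1+d ⟩
    ∣ chain (suc d) 0 x ∣         ≡⟨ chain-unit d 0 x (sym k≡1+d) ⟩
    1 ∎
    where
    open ≡-Reasoning
    empty-prefix : ∀ y → zeroOn ∅ y · 𝟙 (someEmpty k 0 y) ≡ 𝟙 (someEmpty k 0 y)
    empty-prefix y = trans (cong (_· 𝟙 (someEmpty k 0 y)) (zeroOn-∅ y)) (ℤ.*-identityˡ _)

-- Perfect matchings when the upper anti-triangle is full

BlockHit : Input n → ℕ → Set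
BlockHit {n} y t = Σ (Fin n) λ a → Σ (Fin n) λ b → toℕ a ≤ t × toℕ b +ℕ t < n × y a b ≡ true

UpperFull : Input n → Set
UpperFull {n} y = ∀ a b → n ≤ toℕ a +ℕ toℕ b → y a b ≡ true

-- Rows 0..t cannot all be matched into the t columns n−t, …, n−1.
matching⇒blockHit : ∀ (y : Input n) → HasPerfectMatching y → ∀ t → t < n → BlockHit y t
matching⇒blockHit {n} y (σ , matched) t t<n
  with Fin.any? (λ a → toℕ a ℕ.≤? t ×-dec toℕ (σ ⟨$⟩ʳ a) +ℕ t ℕ.<? n)
... | yes (a , a≤t , b+t<n) = a , σ ⟨$⟩ʳ a , a≤t , b+t<n , matched a
... | no ¬hit = contradiction (Fin.injective⇒≤ excess-injective) ℕ.1+n≰n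
  where
  row : Fin (suc t) → Fin n
  row i = fromℕ< (ℕ.<-≤-trans (Fin.toℕ<n i) t<n)
  column : Fin (suc t) → ℕ
  column i = toℕ (σ ⟨$⟩ʳ row i)
  far : ∀ i → n ≤ column i +ℕ t
  far i = ℕ.≮⇒≥ λ lt →
    ¬hit (row i , ℕ.≤-trans (ℕ.≤-reflexive (Fin.toℕ-fromℕ< _)) (s≤s⁻¹ (Fin.toℕ<n i)) , lt)
  excess< : ∀ i → column i +ℕ t ∸ n < t
  excess< i = subst (column i +ℕ t ∸ n <_) (ℕ.m+n∸m≡n n t)
    (ℕ.∸-monoˡ-< (ℕ.+-monoˡ-< t (Fin.toℕ<n (σ ⟨$⟩ʳ row i))) (far i))
  excess : Fin (suc t) → Fin t
  excess i = fromℕ< (excess< i)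
  excess-injective : ∀ {i j} → excess i ≡ excess j → i ≡ j
  excess-injective {i} {j} e = Fin.toℕ-injective (begin
    toℕ i                       ≡⟨ sym (Fin.toℕ-fromℕ< _) ⟩
    toℕ (row i)                 ≡⟨ cong toℕ (sym (inverseˡ σ)) ⟩
    toℕ (σ ⟨$⟩ˡ (σ ⟨$⟩ʳ row i)) ≡⟨ cong (toℕ ∘ (σ ⟨$⟩ˡ_)) (Fin.toℕ-injective same-column) ⟩
    toℕ (σ ⟨$⟩ˡ (σ ⟨$⟩ʳ row j)) ≡⟨ cong toℕ (inverseˡ σ) ⟩
    toℕ (row j)                 ≡⟨ Fin.toℕ-fromℕ< _ ⟩
    toℕ j ∎)
    where
    open ≡-Reasoning
    same-column : column i ≡ column j
    same-column = ℕ.+-cancelʳ-≡ t _ _ (ℕ.∸-cancelʳ-≡ (far i) (far j)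
      (trans (sym (Fin.toℕ-fromℕ< (excess< i))) (trans (cong toℕ e) (Fin.toℕ-fromℕ< (excess< j)))))

toℕ-punchIn-≥ : ∀ {k} (i : Fin (suc k)) j → toℕ j ≤ toℕ (punchIn i j)
toℕ-punchIn-≥ zero    j       = ℕ.n≤1+n (toℕ j)
toℕ-punchIn-≥ (suc i) zero    = z≤n
toℕ-punchIn-≥ (suc i) (suc j) = s≤s (toℕ-punchIn-≥ i j)

toℕ-punchIn-above : ∀ {k} (i : Fin (suc k)) j → toℕ i ≤ toℕ j → toℕ (punchIn i j) ≡ suc (toℕ j)
toℕ-punchIn-above zero    j       _         = refl
toℕ-punchIn-above (suc i) (suc j) (s≤s i≤j) = cong suc (toℕ-punchIn-above i j i≤j)

∸-suc-< : ∀ {t n} → t < n → n ∸ suc t < n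
∸-suc-< = ℕ.∸-monoʳ-< (s≤s z≤n)

leastTrue : ∀ {k} (p : Fin k → Bool) {a} → p a ≡ true →
  Σ (Fin k) λ i → p i ≡ true × (∀ j → toℕ j < toℕ i → p j ≡ false)
leastTrue p {zero}  pa = zero , pa , λ _ ()
leastTrue p {suc a} pa with p zero in p₀
... | true  = zero , p₀ , λ _ ()
... | false =
  let (i , pi , below) = leastTrue (p ∘ suc) pa in
  suc i , pi , λ { zero _ → p₀ ; (suc j) j<i → below j (s≤s⁻¹ j<i) }

minor : ∀ {k} → Fin (suc k) → Input (suc k) → Input k
minor p y a b = y (punchIn p a) (suc b)

minor-upperFull : ∀ {k} p (y : Input (suc k)) → UpperFull y → UpperFull (minor p y)
minor-upperFull p y full a b k≤a+b = full _ _ (begin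
  suc _                           ≤⟨ s≤s k≤a+b ⟩
  suc (toℕ a +ℕ toℕ b)             ≡⟨ sym (ℕ.+-suc (toℕ a) (toℕ b)) ⟩
  toℕ a +ℕ suc (toℕ b)             ≤⟨ ℕ.+-monoˡ-≤ (suc (toℕ b)) (toℕ-punchIn-≥ p a) ⟩
  toℕ (punchIn p a) +ℕ suc (toℕ b) ∎)
  where open ℕ.≤-Reasoning

minor-blockHit-below : ∀ {k} p (y : Input (suc k)) → (∀ a → toℕ a < toℕ p → y a zero ≡ false) →
  ∀ t → t < toℕ p → BlockHit y t → BlockHit (minor p y) t
minor-blockHit-below p y no-edge t t<p (a , zero , a≤t , _ , yab) =
  contradiction (trans (sym yab) (no-edge a (ℕ.≤-<-trans a≤t t<p))) λ ()
minor-blockHit-below p y no-edge t t<p (a , suc b , a≤t , b+t<k , yab) =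
  punchOut p≢a , b , ℕ.≤-trans a′≤a a≤t , s≤s⁻¹ b+t<k ,
  subst (λ r → y r (suc b) ≡ true) (sym (Fin.punchIn-punchOut p≢a)) yab
  where
  p≢a : p ≢ a
  p≢a refl = ℕ.<⇒≱ t<p a≤t
  a′≤a : toℕ (punchOut p≢a) ≤ toℕ a
  a′≤a = subst (λ r → toℕ (punchOut p≢a) ≤ toℕ r) (Fin.punchIn-punchOut p≢a) (toℕ-punchIn-≥ p _)

-- For t ≥ p the minor's cell (t, k−1−t) is y's cell (t+1, k−t), on the full anti-diagonal a + b = k + 1.
minor-blockHit-above : ∀ {k} p (y : Input (suc k)) → UpperFull y →
  ∀ t → toℕ p ≤ t → t < k → BlockHit (minor p y) t
minor-blockHit-above {k} p y full t p≤t t<k =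
  fromℕ< t<k , fromℕ< b<k , ℕ.≤-reflexive (Fin.toℕ-fromℕ< t<k) , b+t<k , full _ _ (ℕ.≤-reflexive (sym sum))
  where
  b<k : k ∸ suc t < k
  b<k = ∸-suc-< t<k
  b+t<k : toℕ (fromℕ< b<k) +ℕ t < k
  b+t<k rewrite Fin.toℕ-fromℕ< b<k =
    ℕ.≤-reflexive (trans (sym (ℕ.+-suc (k ∸ suc t) t)) (ℕ.m∸n+n≡m t<k))
  sum : toℕ (punchIn p (fromℕ< t<k)) +ℕ toℕ (suc (fromℕ< b<k)) ≡ suc k
  sum rewrite toℕ-punchIn-above p (fromℕ< t<k) (subst (toℕ p ≤_) (sym (Fin.toℕ-fromℕ< t<k)) p≤t)
            | Fin.toℕ-fromℕ< t<k | Fin.toℕ-fromℕ< b<k =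
    cong suc (trans (ℕ.+-suc t (k ∸ suc t)) (ℕ.m+[n∸m]≡n t<k))

column₀-edge : ∀ {k} (y : Input (suc k)) → BlockHit y k → Σ (Fin (suc k)) λ a → y a zero ≡ true
column₀-edge y (a , zero  , _ , _       , yab) = a , yab
column₀-edge y (a , suc b , _ , b+k<1+k , _)   = contradiction (s≤s⁻¹ b+k<1+k) (ℕ.m+n≮n (toℕ b) _)

-- Match the first row adjacent to column 0 with it, and recurse on the minor.
blockHit⇒matching : ∀ (y : Input n) → UpperFull y → (∀ t → t < n → BlockHit y t) → HasPerfectMatching y
blockHit⇒matching {zero}  y full hits = Perm.id , λ ()
blockHit⇒matching {suc k} y full hits = insert p zero π , matched
  where
  first = leastTrue (λ a → y a zero) (proj₂ (column₀-edge y (hits k ℕ.≤-refl)))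
  p = proj₁ first
  minor-hits : ∀ t → t < k → BlockHit (minor p y) t
  minor-hits t t<k with t ℕ.<? toℕ p
  ... | yes t<p = minor-blockHit-below p y (proj₂ (proj₂ first)) t t<p (hits t (ℕ.m<n⇒m<1+n t<k))
  ... | no  t≮p = minor-blockHit-above p y full t (ℕ.≮⇒≥ t≮p) t<k
  minor-matching = blockHit⇒matching (minor p y) (minor-upperFull p y full) minor-hits
  π = proj₁ minor-matching
  matched : ∀ a → y a (insert p zero π ⟨$⟩ʳ a) ≡ true
  matched a with p Fin.≟ a
  ... | yes refl = proj₁ (proj₂ first)
  ... | no  p≢a  = subst (λ r → y r (suc (π ⟨$⟩ʳ punchOut p≢a)) ≡ true) (Fin.punchIn-punchOut p≢a)
                         (proj₂ minor-matching (punchOut p≢a))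

-- The staircase and its blocks

from-does : ∀ {A : Set} (d : Dec A) → does d ≡ true → A
from-does (yes a) _ = a

from-does-false : ∀ {A : Set} (d : Dec A) → does d ≡ false → ¬ A
from-does-false (no ¬a) _ = ¬a

InStair : ∀ n → Cell n → Set
InStair n (i , j) = toℕ i +ℕ toℕ j < n

inStair? : ∀ n (c : Cell n) → Dec (InStair n c)
inStair? n (i , j) = toℕ i +ℕ toℕ j ℕ.<? n

stair : BitSet n
stair {n} i j = does (inStair? n (i , j))

staircase : ∀ n → List (Cell n)
staircase n = filter (inStair? n) (cartesianProduct (allFin n) (allFin n))

staircase-unique : Unique (staircase n)
staircase-unique {n} = filter⁺ (inStair? n) (cartesianProduct⁺ (allFin⁺ n) (allFin⁺ n))

∈-staircase⁺ : ∀ {i j : Fin n} → InStair n (i , j) → (i , j) ∈ staircase n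
∈-staircase⁺ {n} {i} {j} = ∈-filter⁺ (inStair? n) (∈-cartesianProduct⁺ (∈-allFin i) (∈-allFin j))

∈-staircase⁻ : ∀ {i j : Fin n} → (i , j) ∈ staircase n → InStair n (i , j)
∈-staircase⁻ {n} ij∈ = proj₂ (∈-filter⁻ (inStair? n) {xs = cartesianProduct (allFin n) (allFin n)} ij∈)

block : ℕ → BitSet n
block {n} t a b = does (toℕ a ℕ.≤? t) ∧ does (toℕ b +ℕ t ℕ.<? n)

block-true⁻ : ∀ t {a b : Fin n} → block t a b ≡ true → toℕ a ≤ t × toℕ b +ℕ t < n
block-true⁻ {n} t {a} {b} e =
  from-does (toℕ a ℕ.≤? t) (∧-conicalˡ _ _ e) , from-does (toℕ b +ℕ t ℕ.<? n) (∧-conicalʳ _ _ e)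

block-true⁺ : ∀ t {a b : Fin n} → toℕ a ≤ t → toℕ b +ℕ t < n → block t a b ≡ true
block-true⁺ {n} t {a} {b} a≤t b+t<n
  rewrite dec-true (toℕ a ℕ.≤? t) a≤t | dec-true (toℕ b +ℕ t ℕ.<? n) b+t<n = refl

orQuery-block⁻ : ∀ t (y : Input n) → orQuery (block t) y ≡ true → BlockHit y t
orQuery-block⁻ t y e =
  let (a , b , bab , yab) = orQuery-sound (block t) y e ; (a≤t , b+t<n) = block-true⁻ t bab
  in a , b , a≤t , b+t<n , yab

orQuery-block⁺ : ∀ t (y : Input n) → BlockHit y t → orQuery (block t) y ≡ true
orQuery-block⁺ t y (a , b , a≤t , b+t<n , yab) =
  orQuery-complete (block t) y (a , b , block-true⁺ t a≤t b+t<n , yab)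

corner : ∀ t → t < n → Cell n
corner t t<n = fromℕ< t<n , fromℕ< (∸-suc-< t<n)

corner∈staircase : ∀ t (t<n : t < n) → corner t t<n ∈ staircase n
corner∈staircase t t<n = ∈-staircase⁺ (subst₂ (λ a b → a +ℕ b < _) (sym (Fin.toℕ-fromℕ< t<n))
  (sym (Fin.toℕ-fromℕ< (∸-suc-< t<n))) (ℕ.≤-reflexive (ℕ.m+[n∸m]≡n t<n)))

corner-private : ∀ t (t<n : t < n) s → s ≢ t → block s (proj₁ (corner t t<n)) (proj₂ (corner t t<n)) ≡ false
corner-private {n} t t<n s s≢t with block s (proj₁ (corner t t<n)) (proj₂ (corner t t<n)) in e
... | false = refl
... | true  = contradiction (ℕ.≤-antisym (s≤s⁻¹ s<1+t) t≤s) s≢t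
  where
  bounds = block-true⁻ s e
  t≤s : t ≤ s
  t≤s = subst (_≤ s) (Fin.toℕ-fromℕ< t<n) (proj₁ bounds)
  s<1+t : s < suc t
  s<1+t = ℕ.+-cancelˡ-< (n ∸ suc t) s (suc t) (begin-strict
    n ∸ suc t +ℕ s        ≡⟨ cong (_+ℕ s) (sym (Fin.toℕ-fromℕ< (∸-suc-< t<n))) ⟩
    toℕ (fromℕ< (∸-suc-< t<n)) +ℕ s <⟨ proj₂ bounds ⟩
    n                     ≡⟨ sym (ℕ.m∸n+n≡m t<n) ⟩
    n ∸ suc t +ℕ suc t    ∎)
    where open ℕ.≤-Reasoning

block⊆staircase : ∀ s (i j : Fin n) → s < n → block s i j ≡ true → (i , j) ∈ staircase n
block⊆staircase s i j _ e = let (i≤s , j+s<n) = block-true⁻ s e in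
  ∈-staircase⁺ (ℕ.≤-<-trans
    (subst (toℕ i +ℕ toℕ j ≤_) (ℕ.+-comm s (toℕ j)) (ℕ.+-monoˡ-≤ (toℕ j) i≤s)) j+s<n)

staircase⊆blocks : ∀ {i j : Fin n} → (i , j) ∈ staircase n → Σ ℕ λ s → s < n × block s i j ≡ true
staircase⊆blocks {n} {i} {j} ij∈ =
  toℕ i , Fin.toℕ<n i ,
  block-true⁺ (toℕ i) ℕ.≤-refl (subst (_< n) (ℕ.+-comm (toℕ i) (toℕ j)) (∈-staircase⁻ ij∈))

module StaircaseChain (n : ℕ) = Chain (staircase n) staircase-unique n block corner
  corner∈staircase corner-private block⊆staircase staircase⊆blocks

open StaircaseChain using (someEmpty; someEmpty-false⁻; someEmpty-false⁺; Δ-someEmpty-unit)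

ones : Input n
ones _ _ = true

upperFull-off-staircase : ∀ {y : Input n} → ones ≈ y off staircase n → UpperFull y
upperFull-off-staircase ones≈y a b n≤a+b = sym (ones≈y a b λ ab∈ → ℕ.<⇒≱ (∈-staircase⁻ ab∈) n≤a+b)

-- Off the staircase everything is an edge, and then Hall's condition reduces to the blocks.
eval-off-staircase : ∀ (T : ORTree n) → ComputesBPM T → ∀ y → ones ≈ y off staircase n →
  eval T y ≡ not (someEmpty n n 0 y)
eval-off-staircase {n} T computes y ones≈y = ⇔→≡ (mk⇔ matched⇒hit hit⇒matched)
  where
  matched⇒hit : eval T y ≡ true → not (someEmpty n n 0 y) ≡ true
  matched⇒hit e = cong not (someEmpty-false⁺ n n 0 y λ s _ s<n →
    orQuery-block⁺ s y (matching⇒blockHit y (Equivalence.to (computes y) e) s s<n))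
  hit⇒matched : not (someEmpty n n 0 y) ≡ true → eval T y ≡ true
  hit⇒matched e = Equivalence.from (computes y) (blockHit⇒matching y (upperFull-off-staircase ones≈y)
    λ t t<n → orQuery-block⁻ t y (someEmpty-false⁻ n n 0 y (not-injective e) t z≤n t<n))

Δ-rejects-unit : ∀ {m} (T : ORTree (suc m)) → ComputesBPM T → ∣ Δ (staircase (suc m)) (rejects T) ones ∣ ≡ 1
Δ-rejects-unit {m} T computes = trans
  (cong ∣_∣ (Δ-cong (staircase (suc m)) λ y ones≈y →
    cong 𝟙 (trans (cong not (eval-off-staircase T computes y ones≈y)) (not-involutive _))))
  (Δ-someEmpty-unit (suc m) refl ones)

nonvanishing⇒stair : ∀ (Y : BitSet n) → Δ (staircase n) (zeroOn Y) ones ≢ 0ℤ → ∀ i j → Y i j ≡ stair i j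
nonvanishing⇒stair {n} Y nz i j with Y i j in Yij | inStair? n (i , j) in inStair
... | true  | yes _  = sym (cong does inStair)
... | false | no  _  = sym (cong does inStair)
... | true  | no  ∉  = contradiction (Δ-zeroOn-extra (staircase n) (∉ ∘ ∈-staircase⁻) Yij refl) nz
... | false | yes ∈  = contradiction (Δ-zeroOn-missing (staircase n) (∈-staircase⁺ ∈) Yij ones) nz

staircase-in-expansion : ∀ {m} (T : ORTree (suc m)) → ComputesBPM T →
  Any (λ t → ∀ i j → proj₂ t i j ≡ stair i j) (expansion T)
staircase-in-expansion {m} T computes =
  Any.map (nonvanishing⇒stair _) (Δ-evalTerms-support L (expansion T) ones nonzero)
  where
  L = staircase (suc m)
  nonzero : Δ L (evalTerms (expansion T)) ones ≢ 0ℤ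
  nonzero e = contradiction (trans (sym (Δ-rejects-unit T computes))
    (cong ∣_∣ (trans (Δ-cong L (λ y _ → rejects≡evalTerms T y)) e))) λ ()

-- Relabelling rows and columns

module Relabel (r s : Permutation′ n) where

  relabelSet : BitSet n → BitSet n
  relabelSet S a b = S (r ⟨$⟩ˡ a) (s ⟨$⟩ˡ b)

  relabelTree : ORTree n → ORTree n
  relabelTree (leaf b)     = leaf b
  relabelTree (node S l t) = node (relabelSet S) (relabelTree l) (relabelTree t)

  relabelTerm : Term n → Term n
  relabelTerm (a , Y) = a , relabelSet Y

  pullback : Input n → Input n
  pullback y i j = y (r ⟨$⟩ʳ i) (s ⟨$⟩ʳ j)

  orQuery-relabel : ∀ S y → orQuery (relabelSet S) y ≡ orQuery S (pullback y)
  orQuery-relabel S y = ⇔→≡ (mk⇔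
    (λ e → let (a , b , Sab , yab) = orQuery-sound (relabelSet S) y e in
      orQuery-complete S (pullback y) (r ⟨$⟩ˡ a , s ⟨$⟩ˡ b , Sab ,
        subst₂ (λ a′ b′ → y a′ b′ ≡ true) (sym (inverseʳ r)) (sym (inverseʳ s)) yab))
    (λ e → let (i , j , Sij , yij) = orQuery-sound S (pullback y) e in
      orQuery-complete (relabelSet S) y (r ⟨$⟩ʳ i , s ⟨$⟩ʳ j ,
        subst₂ (λ i′ j′ → S i′ j′ ≡ true) (sym (inverseˡ r)) (sym (inverseˡ s)) Sij , yij)))

  eval-relabel : ∀ T y → eval (relabelTree T) y ≡ eval T (pullback y)
  eval-relabel (leaf b)     y = refl
  eval-relabel (node S l t) y with orQuery (relabelSet S) y | orQuery S (pullback y) | orQuery-relabel S y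
  ... | true  | .true  | refl = eval-relabel t y
  ... | false | .false | refl = eval-relabel l y

  matching-pullback⁻ : ∀ y → HasPerfectMatching (pullback y) → HasPerfectMatching y
  matching-pullback⁻ y (σ , matched) = flip r ∘ₚ σ ∘ₚ s , λ a →
    subst (λ a′ → y a′ (s ⟨$⟩ʳ (σ ⟨$⟩ʳ (r ⟨$⟩ˡ a))) ≡ true) (inverseʳ r) (matched (r ⟨$⟩ˡ a))

  matching-pullback⁺ : ∀ y → HasPerfectMatching y → HasPerfectMatching (pullback y)
  matching-pullback⁺ y (σ , matched) = r ∘ₚ σ ∘ₚ flip s , λ i →
    subst (λ b → y (r ⟨$⟩ʳ i) b ≡ true) (sym (inverseʳ s)) (matched (r ⟨$⟩ʳ i))

  computes-relabel : ∀ T → ComputesBPM T → ComputesBPM (relabelTree T)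
  computes-relabel T computes y = mk⇔
    (λ e → matching-pullback⁻ y (Equivalence.to (computes (pullback y)) (trans (sym (eval-relabel T y)) e)))
    (λ m → trans (eval-relabel T y) (Equivalence.from (computes (pullback y)) (matching-pullback⁺ y m)))

  map-relabel-comm : ∀ (f g : Term n → Term n) → (∀ t → relabelTerm (f t) ≡ g (relabelTerm t)) →
    ∀ ts → map relabelTerm (map f ts) ≡ map g (map relabelTerm ts)
  map-relabel-comm f g comm ts = trans (sym (map-∘ ts)) (trans (map-cong comm ts) (map-∘ ts))

  expansion-relabel : ∀ T → expansion (relabelTree T) ≡ map relabelTerm (expansion T)
  expansion-relabel (leaf true)  = refl
  expansion-relabel (leaf false) = refl
  expansion-relabel (node S l t) rewrite expansion-relabel l | expansion-relabel t
    | map-++ relabelTerm (map (restrict S) (expansion l))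
                         (expansion t ++ map (restrict S ∘ negate) (expansion t))
    | map-++ relabelTerm (expansion t) (map (restrict S ∘ negate) (expansion t))
    | map-relabel-comm (restrict S) (restrict (relabelSet S)) (λ _ → refl) (expansion l)
    | map-relabel-comm (restrict S ∘ negate) (restrict (relabelSet S) ∘ negate) (λ _ → refl)
                       (expansion t) = refl

StairPattern : Permutation′ n × Permutation′ n → BitSet n → Set
StairPattern (r , s) Y = ∀ i j → Y i j ≡ stair (r ⟨$⟩ʳ i) (s ⟨$⟩ʳ j)

relabelled-staircase-in-expansion : ∀ {m} (T : ORTree (suc m)) → ComputesBPM T → ∀ rs →
  Any (λ t → StairPattern rs (proj₂ t)) (expansion T)
relabelled-staircase-in-expansion {m} T computes (r , s) =
  Any.map (λ {(a , Y)} relabelled i j →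
      trans (sym (cong₂ Y (inverseˡ r) (inverseˡ s))) (relabelled (r ⟨$⟩ʳ i) (s ⟨$⟩ʳ j)))
    (map⁻ (subst (Any _) (expansion-relabel T)
      (staircase-in-expansion (relabelTree T) (computes-relabel T computes))))
  where open Relabel {suc m} r s

-- A relabelled staircase determines the relabelling

stair-comm : ∀ (a b : Fin n) → stair a b ≡ stair b a
stair-comm {n} a b = cong (λ k → does (k ℕ.<? n)) (ℕ.+-comm (toℕ a) (toℕ b))

OrderPreserved : (Fin n → Fin n) → (Fin n → Fin n) → Set
OrderPreserved u u′ = ∀ x x′ → toℕ (u x) < toℕ (u x′) → toℕ (u′ x) < toℕ (u′ x′)

-- Column v⁻¹(n−1−u x) separates row x from every row x′ with u x < u x′.
stair-order : ∀ (u u′ : Fin n → Fin n) (v v′ : Permutation′ n) →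
  (∀ x y → stair (u x) (v ⟨$⟩ʳ y) ≡ stair (u′ x) (v′ ⟨$⟩ʳ y)) → OrderPreserved u u′
stair-order {n} u u′ v v′ same x x′ ux<ux′ =
  ℕ.+-cancelʳ-< (toℕ (v′ ⟨$⟩ʳ y)) _ _ (ℕ.<-≤-trans
    (from-does (inStair? n (u′ x , v′ ⟨$⟩ʳ y)) in-x)
    (ℕ.≮⇒≥ (from-does-false (inStair? n (u′ x′ , v′ ⟨$⟩ʳ y)) out-x′)))
  where
  b = fromℕ< (∸-suc-< (Fin.toℕ<n (u x)))
  y = v ⟨$⟩ˡ b
  vy : toℕ (v ⟨$⟩ʳ y) ≡ n ∸ suc (toℕ (u x))
  vy = trans (cong toℕ (inverseʳ v)) (Fin.toℕ-fromℕ< _)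
  in-x : stair (u′ x) (v′ ⟨$⟩ʳ y) ≡ true
  in-x = trans (sym (same x y)) (dec-true (inStair? n (u x , v ⟨$⟩ʳ y))
    (subst (λ c → toℕ (u x) +ℕ c < n) (sym vy) (ℕ.≤-reflexive (ℕ.m+[n∸m]≡n (Fin.toℕ<n (u x))))))
  out-x′ : stair (u′ x′) (v′ ⟨$⟩ʳ y) ≡ false
  out-x′ = trans (sym (same x′ y)) (dec-false (inStair? n (u x′ , v ⟨$⟩ʳ y)) (ℕ.≤⇒≯
    (subst (_≤ toℕ (u x′) +ℕ toℕ (v ⟨$⟩ʳ y))
      (trans (cong (λ c → suc (toℕ (u x) +ℕ c)) vy) (ℕ.m+[n∸m]≡n (Fin.toℕ<n (u x))))
      (ℕ.+-monoˡ-< (toℕ (v ⟨$⟩ʳ y)) ux<ux′))))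

strictMono-inflationary : ∀ (f : Fin n → Fin n) → OrderPreserved (λ a → a) f → ∀ a → toℕ a ≤ toℕ (f a)
strictMono-inflationary {n} f mono a = bound (toℕ a) a refl
  where
  bound : ∀ k (a : Fin n) → toℕ a ≡ k → k ≤ toℕ (f a)
  bound zero    a _     = z≤n
  bound (suc k) a a≡1+k = ℕ.≤-<-trans (bound k a′ (Fin.toℕ-fromℕ< k<n)) (mono a′ a a′<a)
    where
    k<n : k < n
    k<n = ℕ.<-trans (subst (k <_) (sym a≡1+k) (ℕ.n<1+n k)) (Fin.toℕ<n a)
    a′ = fromℕ< k<n
    a′<a : toℕ a′ < toℕ a
    a′<a = subst₂ _<_ (sym (Fin.toℕ-fromℕ< k<n)) (sym a≡1+k) (ℕ.n<1+n k)

order-dominated : ∀ (σ σ′ : Permutation′ n) → OrderPreserved (σ ⟨$⟩ʳ_) (σ′ ⟨$⟩ʳ_) →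
  ∀ i → toℕ (σ ⟨$⟩ʳ i) ≤ toℕ (σ′ ⟨$⟩ʳ i)
order-dominated σ σ′ preserved i = subst (λ z → toℕ (σ ⟨$⟩ʳ i) ≤ toℕ (σ′ ⟨$⟩ʳ z)) (inverseˡ σ)
  (strictMono-inflationary (λ a → σ′ ⟨$⟩ʳ (σ ⟨$⟩ˡ a))
    (λ a b a<b → preserved _ _
       (subst₂ (λ a′ b′ → toℕ a′ < toℕ b′) (sym (inverseʳ σ)) (sym (inverseʳ σ)) a<b))
    (σ ⟨$⟩ʳ i))

order-rigid : ∀ (ρ ρ′ : Permutation′ n) → OrderPreserved (ρ ⟨$⟩ʳ_) (ρ′ ⟨$⟩ʳ_) →
  OrderPreserved (ρ′ ⟨$⟩ʳ_) (ρ ⟨$⟩ʳ_) → ∀ i → ρ ⟨$⟩ʳ i ≡ ρ′ ⟨$⟩ʳ i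
order-rigid ρ ρ′ preserved preserved′ i =
  Fin.toℕ-injective (ℕ.≤-antisym (order-dominated ρ ρ′ preserved i) (order-dominated ρ′ ρ preserved′ i))

stair-rows-determined : ∀ (r s r′ s′ : Permutation′ n) →
  (∀ i j → stair (r ⟨$⟩ʳ i) (s ⟨$⟩ʳ j) ≡ stair (r′ ⟨$⟩ʳ i) (s′ ⟨$⟩ʳ j)) → ∀ i → r ⟨$⟩ʳ i ≡ r′ ⟨$⟩ʳ i
stair-rows-determined r s r′ s′ same = order-rigid r r′
  (stair-order (r ⟨$⟩ʳ_) (r′ ⟨$⟩ʳ_) s s′ same)
  (stair-order (r′ ⟨$⟩ʳ_) (r ⟨$⟩ʳ_) s′ s (λ x y → sym (same x y)))

stair-pattern-determined : ∀ (r s r′ s′ : Permutation′ n) →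
  (∀ i j → stair (r ⟨$⟩ʳ i) (s ⟨$⟩ʳ j) ≡ stair (r′ ⟨$⟩ʳ i) (s′ ⟨$⟩ʳ j)) →
  (∀ i → r ⟨$⟩ʳ i ≡ r′ ⟨$⟩ʳ i) × (∀ j → s ⟨$⟩ʳ j ≡ s′ ⟨$⟩ʳ j)
stair-pattern-determined r s r′ s′ same =
  stair-rows-determined r s r′ s′ same ,
  stair-rows-determined s r s′ r′ λ j i →
    trans (stair-comm (s ⟨$⟩ʳ j) (r ⟨$⟩ʳ i)) (trans (same i j) (stair-comm (r′ ⟨$⟩ʳ i) (s′ ⟨$⟩ʳ j)))

insert-at : ∀ {k} (i : Fin (suc k)) (π : Permutation′ k) → insert i zero π ⟨$⟩ʳ i ≡ zero
insert-at i π with i Fin.≟ i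
... | yes _  = refl
... | no i≢i = contradiction refl i≢i

enumerate : ∀ n → Fin (n !) → Permutation′ n
enumerate zero    _ = Perm.id
enumerate (suc n) k = let (i , rest) = remQuot {suc n} (n !) k in insert i zero (enumerate n rest)

-- k is recovered from the preimage of 0 and, recursively, from the rest of the permutation.
enumerate-injective : ∀ n (k k′ : Fin (n !)) → (∀ i → enumerate n k ⟨$⟩ʳ i ≡ enumerate n k′ ⟨$⟩ʳ i) → k ≡ k′
enumerate-injective zero    zero zero _ = refl
enumerate-injective (suc n) k    k′   same = begin
  k                  ≡⟨ sym (Fin.combine-remQuot {suc n} (n !) k) ⟩
  combine i rest     ≡⟨ cong₂ combine i≡i′ rest≡rest′ ⟩
  combine i′ rest′   ≡⟨ Fin.combine-remQuot {suc n} (n !) k′ ⟩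
  k′ ∎
  where
  open ≡-Reasoning
  i     = proj₁ (remQuot {suc n} (n !) k)
  rest  = proj₂ (remQuot {suc n} (n !) k)
  i′    = proj₁ (remQuot {suc n} (n !) k′)
  rest′ = proj₂ (remQuot {suc n} (n !) k′)
  π  = enumerate n rest
  π′ = enumerate n rest′
  i≡i′ : i ≡ i′
  i≡i′ with i′ Fin.≟ i
  ... | yes i′≡i = sym i′≡i
  ... | no  i′≢i = contradiction (begin
    zero                                       ≡⟨ sym (insert-at i π) ⟩
    insert i zero π ⟨$⟩ʳ i                     ≡⟨ same i ⟩
    insert i′ zero π′ ⟨$⟩ʳ i
      ≡⟨ cong (insert i′ zero π′ ⟨$⟩ʳ_) (sym (Fin.punchIn-punchOut i′≢i)) ⟩
    insert i′ zero π′ ⟨$⟩ʳ punchIn i′ (punchOut i′≢i) ≡⟨ insert-punchIn i′ zero π′ (punchOut i′≢i) ⟩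
    suc (π′ ⟨$⟩ʳ punchOut i′≢i) ∎) λ ()
  rest≡rest′ : rest ≡ rest′
  rest≡rest′ = enumerate-injective n rest rest′ λ a → Fin.suc-injective (begin
    suc (π ⟨$⟩ʳ a)                       ≡⟨ sym (insert-punchIn i zero π a) ⟩
    insert i zero π ⟨$⟩ʳ punchIn i a     ≡⟨ same (punchIn i a) ⟩
    insert i′ zero π′ ⟨$⟩ʳ punchIn i a   ≡⟨ cong (λ i″ → insert i′ zero π′ ⟨$⟩ʳ punchIn i″ a) i≡i′ ⟩
    insert i′ zero π′ ⟨$⟩ʳ punchIn i′ a  ≡⟨ insert-punchIn i′ zero π′ a ⟩
    suc (π′ ⟨$⟩ʳ a) ∎)

decodePair : ∀ n → Fin (n ! * n !) → Permutation′ n × Permutation′ n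
decodePair n p = let (a , b) = remQuot {n !} (n !) p in enumerate n a , enumerate n b

stairPattern-injective : ∀ {n} (p q : Fin (n ! * n !)) {Y : BitSet n} →
  StairPattern (decodePair n p) Y → StairPattern (decodePair n q) Y → p ≡ q
stairPattern-injective {n} p q pattern-p pattern-q = begin
  p                     ≡⟨ sym (Fin.combine-remQuot {n !} (n !) p) ⟩
  combine p₁ p₂         ≡⟨ cong₂ combine (enumerate-injective n p₁ q₁ rows)
                                         (enumerate-injective n p₂ q₂ columns) ⟩
  combine q₁ q₂         ≡⟨ Fin.combine-remQuot {n !} (n !) q ⟩
  q ∎
  where
  open ≡-Reasoning
  p₁ = proj₁ (remQuot {n !} (n !) p)
  p₂ = proj₂ (remQuot {n !} (n !) p)
  q₁ = proj₁ (remQuot {n !} (n !) q)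
  q₂ = proj₂ (remQuot {n !} (n !) q)
  determined = stair-pattern-determined (enumerate n p₁) (enumerate n p₂) (enumerate n q₁) (enumerate n q₂)
    λ i j → trans (sym (pattern-p i j)) (pattern-q i j)
  rows    = proj₁ determined
  columns = proj₂ determined

index-injective : ∀ {A I : Set} {P : I → A → Set} (xs : List A) (w : ∀ i → Any (P i) xs) →
  (∀ {i j a} → P i a → P j a → i ≡ j) → ∀ {i j} → Any.index (w i) ≡ Any.index (w j) → i ≡ j
index-injective {P = P} xs w unique {i} {j} e =
  unique (lookup-index (w i)) (subst (λ k → P j (lookup xs k)) (sym e) (lookup-index (w j)))

corollary4p21 : (n : ℕ) (T : ORTree n) → ComputesBPM T → (n !) * (n !) ≤ 3 ^ depth T
corollary4p21 zero    T _        = ℕ.m^n>0 3 (depth T)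
corollary4p21 (suc m) T computes =
  ℕ.≤-trans (Fin.injective⇒≤ (index-injective (expansion T) witness (stairPattern-injective _ _)))
            (length-expansion T)
  where
  witness : ∀ p → Any (λ t → StairPattern (decodePair (suc m) p) (proj₂ t)) (expansion T)
  witness p = relabelled-staircase-in-expansion T computes (decodePair (suc m) p)
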